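{- Let $i\ge 0$ be an integer. All geodesic triangles in an $\alpha_i$-metric graph $G$ are $3(i+1)$-thin.
   Context: All graphs are finite, undirected, unweighted, simple and connected; $d$ is the shortest-path distance and $I(u,v)=\{w : d(u,v)=d(u,w)+d(w,v)\}$. A graph is $\alpha_i$-metric if for all vertices $u,v,w,x$ with $v\in I(u,w)$, $w\in I(v,x)$ and $v,w$ adjacent, $d(u,x)\ge d(u,v)+d(v,x)-i$. A geodesic triangle $\Delta(x,y,z)=P(x,y)\cup P(y,z)\cup P(z,x)$ is the union of a shortest $(x,y)$-path, a shortest $(y,z)$-path and a shortest $(z,x)$-path. The Gromov product is $(x\mid y)_z=\frac12(d(x,z)+d(y,z)-d(x,y))$. Let $T(x,y,z)$ be the metric star (tree) with leaves $x,y,z$ whose edges to the center have lengths $(y\mid z)_x$, $(z\mid x)_y$, $(x\mid y)_z$ respectively (edges viewed as continuous segments), and let $\varphi:\Delta(x,y,z)\to T(x,y,z)$ be the unique map whose restriction to each side $P(x,y),P(y,z),P(z,x)$ is an isometry onto the corresponding path of $T$. The triangle is $\delta$-thin if for all vertices $u,v$ of $\Delta(x,y,z)$ with $\varphi(u)=\varphi(v)$ one has $d_G(u,v)\le\delta$. -}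

module Defs where

open import Level using (0ℓ)
open import Data.Nat using (ℕ; zero; suc; _+_; _*_; _≤_; _<_)
open import Data.Fin using (Fin)
open import Data.Product using (_×_)
open import Relation.Nullary using (¬_)
open import Relation.Binary.PropositionalEquality using (_≡_)

record Graph : Set₁ where
  field
    n     : ℕ
    Adj   : Fin n → Fin n → Set
    sym   : ∀ {u v} → Adj u v → Adj v u
    irrefl : ∀ {u} → ¬ Adj u u

module _ (G : Graph) where
  open Graph G

  V : Set
  V = Fin n

  data Walk : V → V → ℕ → Set where
    here : ∀ {u} → Walk u u zero
    step : ∀ {u w v m} → Adj u w → Walk w v m → Walk u v (suc m)

  -- d is the shortest-path distance of G (this also forces G to be connected)
  IsDistance : (V → V → ℕ) → Set
  IsDistance d = ∀ u v → Walk u v (d u v) × (∀ m → Walk u v m → d u v ≤ m)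

  module _ (d : V → V → ℕ) where

    InInterval : V → V → V → Set
    InInterval w u v = d u v ≡ d u w + d w v

    AlphaMetric : ℕ → Set
    AlphaMetric i = ∀ u v w x → InInterval v u w → InInterval w v x → Adj v w →
                    d u v + d v x ≤ d u x + i

    IsGeodesic : V → V → (ℕ → V) → Set
    IsGeodesic x y p = (p 0 ≡ x) × (p (d x y) ≡ y) × (∀ k → k < d x y → Adj (p k) (p (suc k)))

    rev : ℕ → (ℕ → V) → ℕ → V
    rev ℓ p k = p (ℓ Data.Nat.∸ k)

    -- Thinness at a corner c with the two sides leaving c, towards a and b
    -- (parametrised from c): the vertices at distance k from c on both sides
    -- have the same φ-image iff k ≤ (a ∣ b)_c, i.e. 2k ≤ d(c,a)+d(c,b)-d(a,b).
    CornerThin : ℕ → V → V → V → (ℕ → V) → (ℕ → V) → Set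
    CornerThin δ c a b p q = ∀ k → 2 * k + d a b ≤ d c a + d c b → d (p k) (q k) ≤ δ

    -- The geodesic triangle with sides pxy = P(x,y), pyz = P(y,z), pzx = P(z,x) is δ-thin.
    -- (Two vertices on the same side have equal φ-image only if they are equal,
    --  so only pairs on different sides need checking; those meet at a common corner.)
    Thin : ℕ → V → V → V → (ℕ → V) → (ℕ → V) → (ℕ → V) → Set
    Thin δ x y z pxy pyz pzx =
      CornerThin δ x y z pxy (rev (d z x) pzx) ×
      CornerThin δ y z x pyz (rev (d x y) pxy) ×
      CornerThin δ z x y pzx (rev (d y z) pyz)

{-# OPTIONS --safe #-}
-- Say that y lies in I(u,v) up to i when d(u,y) + d(y,v) ≤ d(u,v) + i.  Following a shortest
-- path from w to v and applying the α_i-condition at the first step that moves away from u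
-- shows: if v ∈ I(w,a) and d(u,w) < d(u,v), then v lies in I(u,a) up to i.  Hence for two
-- vertices y, y′ at distance i + 1 on a geodesic from c to a, every u sees y′ in I(u,a) up
-- to i with d(u,y) ≤ d(u,y′), or y in I(u,c) up to i with d(u,y′) ≤ d(u,y).
-- At a corner c, let x, y be the points at distance k ≤ (a|b)_c from c on the sides towards
-- a and b.  Applying this to b and the segment of [c,a] starting at x gives
-- d(x,b) ≤ d(y,b) + 2i + 1; applying it to x and the segment of [c,b] ending at y then
-- gives d(x,y) ≤ 3i + 1.
module Submission where

open import Defs
open import Data.Nat using (ℕ; zero; suc; _+_; _*_; _∸_; _≤_; _<_; _≟_; _≤?_)
open import Data.Nat.Properties
open import Data.Nat.Tactic.RingSolver using (solve)
open import Data.List using (_∷_; [])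
open import Data.Product using (_×_; _,_; proj₁; proj₂; ∃-syntax)
open import Data.Sum using (_⊎_; inj₁; inj₂)
import Data.Sum as Sum
open import Data.Empty using (⊥-elim)
open import Relation.Nullary using (yes; no)
open import Relation.Binary.Definitions using (tri<; tri≈; tri>)
open import Relation.Binary.PropositionalEquality
open ≤-Reasoning

≤-squeeze : ∀ {x y m n} → x ≤ m → y ≤ n → m + n ≤ x + y → x ≡ m × y ≡ n
≤-squeeze {x} {y} {m} {n} x≤m y≤n m+n≤x+y =
  ≤-antisym x≤m (+-cancelʳ-≤ n m x (≤-trans m+n≤x+y (+-monoʳ-≤ x y≤n))) ,
  ≤-antisym y≤n (+-cancelˡ-≤ m n y (≤-trans m+n≤x+y (+-monoˡ-≤ y x≤m)))

gromov⇒≤ : ∀ {k D A B} → 2 * k + D ≤ A + B → B ≤ A + D → k ≤ A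
gromov⇒≤ {k} {D} {A} {B} h B≤A+D = *-cancelˡ-≤ 2 (+-cancelʳ-≤ D (2 * k) (2 * A) (begin
  2 * k + D    ≤⟨ h ⟩
  A + B        ≤⟨ +-monoʳ-≤ A B≤A+D ⟩
  A + (A + D)  ≡⟨ solve (A ∷ D ∷ []) ⟩
  2 * A + D    ∎))

gromov⇒split : ∀ {k D A B} → 2 * k + D ≤ A + B → B ≤ A + D → A ≤ B + D →
               ∃[ e ] ∃[ f ] k + e ≡ A × k + f ≡ B × D ≤ e + f
gromov⇒split {k} {D} {A} {B} h B≤A+D A≤B+D
  with m≤n⇒∃[o]m+o≡n (gromov⇒≤ {k} {D} {A} {B} h B≤A+D)
     | m≤n⇒∃[o]m+o≡n (gromov⇒≤ {k} {D} {B} {A} (≤-trans h (≤-reflexive (+-comm A B))) A≤B+D)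
... | e , refl | f , refl = e , f , refl , refl , +-cancelˡ-≤ (2 * k) D (e + f) (begin
  2 * k + D              ≤⟨ h ⟩
  k + e + (k + f)        ≡⟨ solve (k ∷ e ∷ f ∷ []) ⟩
  2 * k + (e + f)        ∎)

module _ {G : Graph} where
  open Graph G using (Adj)

  _++ʷ_ : ∀ {u v w m n} → Walk G u v m → Walk G v w n → Walk G u w (m + n)
  here     ++ʷ q = q
  step a p ++ʷ q = step a (p ++ʷ q)

  snocʷ : ∀ {u v w m} → Walk G u v m → Adj v w → Walk G u w (suc m)
  snocʷ here       b = step b here
  snocʷ (step a p) b = step a (snocʷ p b)

  reverseʷ : ∀ {u v m} → Walk G u v m → Walk G v u m
  reverseʷ here       = here
  reverseʷ (step a p) = snocʷ (reverseʷ p) (Graph.sym G a)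

module _ (G : Graph) (d : V G → V G → ℕ) where

  AlmostInInterval : ℕ → V G → V G → V G → Set
  AlmostInInterval i w u v = d u w + d w v ≤ d u v + i

module _ {G : Graph} {d : V G → V G → ℕ} (isD : IsDistance G d) where
  open Graph G using (Adj)

  shortest : ∀ u v → Walk G u v (d u v)
  shortest u v = proj₁ (isD u v)

  d≤walk : ∀ {u v m} → Walk G u v m → d u v ≤ m
  d≤walk {u} {v} {m} = proj₂ (isD u v) m

  d-triangle : ∀ u v w → d u w ≤ d u v + d v w
  d-triangle u v w = d≤walk (shortest u v ++ʷ shortest v w)

  d-sym : ∀ u v → d u v ≡ d v u
  d-sym u v = ≤-antisym (d≤walk (reverseʷ (shortest v u))) (d≤walk (reverseʷ (shortest u v)))

  d≡0⇒≡ : ∀ {u v} → d u v ≡ 0 → u ≡ v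
  d≡0⇒≡ {u} {v} uv≡0 = empty-walk (subst (Walk G u v) uv≡0 (shortest u v))
    where
    empty-walk : Walk G u v 0 → u ≡ v
    empty-walk here = refl

  adj⇒d≡1 : ∀ {u v} → Adj u v → d u v ≡ 1
  adj⇒d≡1 {u} u~v = ≤-antisym (d≤walk (step u~v here))
    (n≢0⇒n>0 (λ uv≡0 → Graph.irrefl G (subst (Adj u) (sym (d≡0⇒≡ uv≡0)) u~v)))

  d-adj≤ : ∀ u {v w} → Adj v w → d u w ≤ suc (d u v)
  d-adj≤ u {v} {w} v~w = begin
    d u w          ≤⟨ d-triangle u v w ⟩
    d u v + d v w  ≡⟨ cong (d u v +_) (adj⇒d≡1 v~w) ⟩
    d u v + 1      ≡⟨ +-comm (d u v) 1 ⟩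
    suc (d u v)    ∎

  d-adj-≢⇒≤ : ∀ u {v w} → Adj v w → d u w ≢ suc (d u v) → d u w ≤ d u v
  d-adj-≢⇒≤ u v~w uw≢ = ≤-pred (≤∧≢⇒< (d-adj≤ u v~w) uw≢)

  neighbour-toward : ∀ {u v n} → d u v ≡ suc n → ∃[ w ] Adj u w × d w v ≡ n
  neighbour-toward {u} {v} {n} uv≡ = first-step (subst (Walk G u v) uv≡ (shortest u v))
    where
    first-step : Walk G u v (suc n) → ∃[ w ] Adj u w × d w v ≡ n
    first-step (step {w = w} u~w rest) = w , u~w , ≤-antisym (d≤walk rest) (≤-pred (begin
      suc n          ≡⟨ sym uv≡ ⟩
      d u v          ≤⟨ d-triangle u w v ⟩
      d u w + d w v  ≡⟨ cong (_+ d w v) (adj⇒d≡1 u~w) ⟩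
      suc (d w v)    ∎))

  InInterval-sym : ∀ {w u v} → InInterval G d w u v → InInterval G d w v u
  InInterval-sym {w} {u} {v} w∈[u,v] = begin-equality
    d v u          ≡⟨ d-sym v u ⟩
    d u v          ≡⟨ w∈[u,v] ⟩
    d u w + d w v  ≡⟨ cong₂ _+_ (d-sym u w) (d-sym w v) ⟩
    d w u + d v w  ≡⟨ +-comm (d w u) (d v w) ⟩
    d v w + d w u  ∎

  ≥⇒InInterval : ∀ {w u v} → d u w + d w v ≤ d u v → InInterval G d w u v
  ≥⇒InInterval {w} {u} {v} = ≤-antisym (d-triangle u w v)

  step-toward⇒InInterval : ∀ {u w v} → Adj u w → d u v ≡ suc (d w v) → InInterval G d w u v
  step-toward⇒InInterval {w = w} {v} u~w uv≡ = trans uv≡ (cong (_+ d w v) (sym (adj⇒d≡1 u~w)))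

  step-away⇒InInterval : ∀ {u v w} → Adj v w → d u w ≡ suc (d u v) → InInterval G d v u w
  step-away⇒InInterval {u} {v} v~w uw≡ =
    trans uw≡ (trans (+-comm 1 (d u v)) (cong (d u v +_) (sym (adj⇒d≡1 v~w))))

  InInterval-trans : ∀ {w w₁ v a} → InInterval G d w₁ w v → InInterval G d v w a →
                     InInterval G d v w₁ a × InInterval G d w₁ w a
  InInterval-trans {w} {w₁} {v} {a} w₁∈[w,v] v∈[w,a] =
    v∈[w₁,a] , trans via-w₁ (cong (d w w₁ +_) (sym v∈[w₁,a]))
    where
    via-w₁ : d w a ≡ d w w₁ + (d w₁ v + d v a)
    via-w₁ = trans v∈[w,a] (trans (cong (_+ d v a) w₁∈[w,v]) (+-assoc (d w w₁) (d w₁ v) (d v a)))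
    v∈[w₁,a] : InInterval G d v w₁ a
    v∈[w₁,a] = ≥⇒InInterval (+-cancelˡ-≤ (d w w₁) _ _ (begin
      d w w₁ + (d w₁ v + d v a)  ≡⟨ sym via-w₁ ⟩
      d w a                      ≤⟨ d-triangle w w₁ a ⟩
      d w w₁ + d w₁ a            ∎))

  module _ {c a : V G} {p : ℕ → V G} (gp : IsGeodesic G d c a p) where

    geodesic-d≤ : ∀ m {j l} → m + j ≡ l → l ≤ d c a → d (p j) (p l) ≤ m
    geodesic-d≤ m refl m+j≤ = d≤walk (along m m+j≤)
      where
      along : ∀ m {j} → m + j ≤ d c a → Walk G (p j) (p (m + j)) m
      along zero    _     = here
      along (suc m) m+j<  = snocʷ (along m (<⇒≤ m+j<)) (proj₂ (proj₂ gp) _ m+j<)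

    geodesic-split : ∀ j m r → j + m + r ≡ d c a →
                     d c (p j) ≡ j × d (p j) (p (j + m)) ≡ m × d (p (j + m)) a ≡ r
    geodesic-split j m r jmr≡ = proj₁ outer , proj₁ inner , proj₂ inner
      where
      j+m≤ : j + m ≤ d c a
      j+m≤ = ≤-trans (m≤m+n (j + m) r) (≤-reflexive jmr≡)
      cpj≤ : d c (p j) ≤ j
      cpj≤ = subst (λ v → d v (p j) ≤ j) (proj₁ gp)
                   (geodesic-d≤ j (+-identityʳ j) (≤-trans (m≤m+n j m) j+m≤))
      pjpl≤ : d (p j) (p (j + m)) ≤ m
      pjpl≤ = geodesic-d≤ m (+-comm m j) j+m≤
      pla≤ : d (p (j + m)) a ≤ r
      pla≤ = subst (λ v → d (p (j + m)) v ≤ r) (proj₁ (proj₂ gp))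
                   (geodesic-d≤ r (trans (+-comm r (j + m)) jmr≡) ≤-refl)
      outer : d c (p j) ≡ j × d (p j) (p (j + m)) + d (p (j + m)) a ≡ m + r
      outer = ≤-squeeze cpj≤ (+-mono-≤ pjpl≤ pla≤) (begin
        j + (m + r)                                          ≡⟨ trans (sym (+-assoc j m r)) jmr≡ ⟩
        d c a                                                ≤⟨ d-triangle c (p j) a ⟩
        d c (p j) + d (p j) a                                ≤⟨ +-monoʳ-≤ _ (d-triangle _ (p (j + m)) a) ⟩
        d c (p j) + (d (p j) (p (j + m)) + d (p (j + m)) a)  ∎)
      inner : d (p j) (p (j + m)) ≡ m × d (p (j + m)) a ≡ r
      inner = ≤-squeeze pjpl≤ pla≤ (≤-reflexive (sym (proj₂ outer)))

    geodesic-d-start : ∀ j r → j + r ≡ d c a → d c (p j) ≡ j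
    geodesic-d-start j r jr≡ = proj₁ (geodesic-split j 0 r (trans (cong (_+ r) (+-identityʳ j)) jr≡))

    geodesic-d-end : ∀ j r → j + r ≡ d c a → d (p j) a ≡ r
    geodesic-d-end j r jr≡ = proj₂ (proj₂ (geodesic-split 0 j r jr≡))

  reverse-geodesic : ∀ {z x p} → IsGeodesic G d z x p → IsGeodesic G d x z (rev G d (d z x) p)
  reverse-geodesic {z} {x} {p} (p₀≡z , pL≡x , adj) = pL≡x , rev-end , rev-adj
    where
    L : ℕ
    L = d z x
    rev-end : p (L ∸ d x z) ≡ z
    rev-end = trans (cong (λ m → p (L ∸ m)) (d-sym x z)) (trans (cong p (n∸n≡0 L)) p₀≡z)
    rev-adj : ∀ k → k < d x z → Adj (p (L ∸ k)) (p (L ∸ suc k))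
    rev-adj k k<xz =
      subst (λ t → Adj (p t) (p (L ∸ suc k))) (sym L∸k≡) (Graph.sym G (adj (L ∸ suc k) L∸1+k<L))
      where
      k<L : k < L
      k<L = subst (k <_) (d-sym x z) k<xz
      L∸k≡ : L ∸ k ≡ suc (L ∸ suc k)
      L∸k≡ = +-∸-assoc 1 k<L
      L∸1+k<L : L ∸ suc k < L
      L∸1+k<L = subst (_≤ L) L∸k≡ (m∸n≤m L k)

  module _ {i : ℕ} (α : AlphaMetric G d i) where

    α-farther : ∀ {u w v a} → InInterval G d v w a → d u w < d u v → AlmostInInterval G d i v u a
    α-farther {u} {w} {v} {a} = descend (d w v) refl
      where
      descend : ∀ n {w} → d w v ≡ n → InInterval G d v w a → d u w < d u v → AlmostInInterval G d i v u a
      descend zero    wv≡0 _ uw<uv = ⊥-elim (<-irrefl (cong (d u) (d≡0⇒≡ wv≡0)) uw<uv)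
      descend (suc n) {w} wv≡ v∈[w,a] uw<uv with neighbour-toward wv≡
      ... | w₁ , w~w₁ , w₁v≡n
        with InInterval-trans (step-toward⇒InInterval w~w₁ (trans wv≡ (cong suc (sym w₁v≡n)))) v∈[w,a]
      ... | v∈[w₁,a] , w₁∈[w,a] with d u w₁ ≟ suc (d u w)
      ... | yes uw₁≡ = begin
        d u v + d v a            ≤⟨ +-monoˡ-≤ (d v a) (d-triangle u w v) ⟩
        d u w + d w v + d v a    ≡⟨ +-assoc (d u w) (d w v) (d v a) ⟩
        d u w + (d w v + d v a)  ≡⟨ cong (d u w +_) (sym v∈[w,a]) ⟩
        d u w + d w a            ≤⟨ α u w w₁ a (step-away⇒InInterval w~w₁ uw₁≡) w₁∈[w,a] w~w₁ ⟩
        d u a + i                ∎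
      ... | no uw₁≢ = descend n w₁v≡n v∈[w₁,a] (≤-<-trans (d-adj-≢⇒≤ u w~w₁ uw₁≢) uw<uv)

    -- Step from y towards u.  The step moves away from c (then α applies at y), or away
    -- from y′ (impossible by α, as d y y′ = i + 1), or neither, and then y′ ∈ I(w, a).
    α-segment-equidistant : ∀ {c y y′ a u h} → InInterval G d y c a → InInterval G d y′ y a →
                            d y y′ ≡ suc i → d u y ≡ d u y′ → d y u ≡ suc h →
                            AlmostInInterval G d i y′ u a ⊎ AlmostInInterval G d i y u c
    α-segment-equidistant {c} {y} {y′} {a} {u} {h} y∈[c,a] y′∈[y,a] yy′≡ uy≡uy′ yu≡
      with neighbour-toward yu≡
    ... | w , y~w , wu≡h with d c w ≟ suc (d c y) | d y′ w ≟ suc (d y′ y)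
    ... | yes cw≡ | _ = inj₂ (begin
      d u y + d y c  ≡⟨ +-comm (d u y) (d y c) ⟩
      d y c + d u y  ≡⟨ cong₂ _+_ (d-sym y c) (d-sym u y) ⟩
      d c y + d y u  ≤⟨ α c y w u (step-away⇒InInterval y~w cw≡) w∈[y,u] y~w ⟩
      d c u + i      ≡⟨ cong (_+ i) (d-sym c u) ⟩
      d u c + i      ∎)
      where
      w∈[y,u] : InInterval G d w y u
      w∈[y,u] = step-toward⇒InInterval y~w (trans yu≡ (cong suc (sym wu≡h)))
    ... | no _ | yes y′w≡ = ⊥-elim (1+n≰n (+-cancelˡ-≤ (suc h) (suc i) i (begin
      suc h + suc i   ≡⟨ +-comm (suc h) (suc i) ⟩
      suc i + suc h   ≡⟨ cong₂ _+_ (trans (sym yy′≡) (d-sym y y′)) (sym yu≡) ⟩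
      d y′ y + d y u  ≤⟨ α y′ y w u (step-away⇒InInterval y~w y′w≡) w∈[y,u] y~w ⟩
      d y′ u + i      ≡⟨ cong (_+ i) (trans (d-sym y′ u) (trans (sym uy≡uy′) (trans (d-sym u y) yu≡))) ⟩
      suc h + i       ∎)))
      where
      w∈[y,u] : InInterval G d w y u
      w∈[y,u] = step-toward⇒InInterval y~w (trans yu≡ (cong suc (sym wu≡h)))
    ... | no cw≢ | no y′w≢ = inj₁ (α-farther y′∈[w,a] uw<uy′)
      where
      wy′≤yy′ : d w y′ ≤ d y y′
      wy′≤yy′ = subst₂ _≤_ (d-sym y′ w) (d-sym y′ y) (d-adj-≢⇒≤ y′ y~w y′w≢)
      y′∈[w,a] : InInterval G d y′ w a
      y′∈[w,a] = ≥⇒InInterval (+-cancelˡ-≤ (d c y) _ _ (begin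
        d c y + (d w y′ + d y′ a)  ≤⟨ +-monoʳ-≤ (d c y) (+-monoˡ-≤ (d y′ a) wy′≤yy′) ⟩
        d c y + (d y y′ + d y′ a)  ≡⟨ cong (d c y +_) (sym y′∈[y,a]) ⟩
        d c y + d y a              ≡⟨ sym y∈[c,a] ⟩
        d c a                      ≤⟨ d-triangle c w a ⟩
        d c w + d w a              ≤⟨ +-monoˡ-≤ (d w a) (d-adj-≢⇒≤ c y~w cw≢) ⟩
        d c y + d w a              ∎))
      uw<uy′ : d u w < d u y′
      uw<uy′ = ≤-reflexive (begin-equality
        suc (d u w)  ≡⟨ cong suc (trans (d-sym u w) wu≡h) ⟩
        suc h        ≡⟨ sym (trans (sym uy≡uy′) (trans (d-sym u y) yu≡)) ⟩
        d u y′       ∎)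

    α-segment : ∀ {c y y′ a} → InInterval G d y c y′ → InInterval G d y′ c a → d y y′ ≡ suc i →
                ∀ u →
                (d u y ≤ d u y′ × AlmostInInterval G d i y′ u a)
              ⊎ (d u y′ ≤ d u y × AlmostInInterval G d i y u c)
    α-segment {c} {y} {y′} {a} y∈[c,y′] y′∈[c,a] yy′≡ u with InInterval-trans y∈[c,y′] y′∈[c,a]
    ... | y′∈[y,a] , y∈[c,a] with <-cmp (d u y) (d u y′)
    ... | tri< uy<uy′ _ _ = inj₁ (<⇒≤ uy<uy′ , α-farther y′∈[y,a] uy<uy′)
    ... | tri> _ _ uy′<uy = inj₂ (<⇒≤ uy′<uy , α-farther (InInterval-sym y∈[c,y′]) uy′<uy)
    ... | tri≈ _ uy≡uy′ _ with d y u in yu≡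
    ... | suc h = Sum.map (≤-reflexive uy≡uy′ ,_) (≤-reflexive (sym uy≡uy′) ,_)
                    (α-segment-equidistant y∈[c,a] y′∈[y,a] yy′≡ uy≡uy′ yu≡)
    ... | zero with ≤-trans (≤-reflexive (sym yy′≡)) (begin
      d y y′          ≤⟨ d-triangle y u y′ ⟩
      d y u + d u y′  ≡⟨ cong₂ _+_ yu≡ (trans (sym uy≡uy′) (trans (d-sym u y) yu≡)) ⟩
      0               ∎)
    ... | ()

    α-geodesic-segment : ∀ {c a p} → IsGeodesic G d c a p →
                         ∀ j {l} r → j + suc i ≡ l → l + r ≡ d c a → ∀ u →
                         (d u (p j) ≤ d u (p l) × AlmostInInterval G d i (p l) u a)
                       ⊎ (d u (p l) ≤ d u (p j) × AlmostInInterval G d i (p j) u c)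
    α-geodesic-segment {c} {a} {p} gp j r refl lr≡ = α-segment y∈[c,y′] y′∈[c,a] yy′≡
      where
      y y′ : V G
      y = p j
      y′ = p (j + suc i)
      cy≡ : d c y ≡ j
      cy≡ = geodesic-d-start gp j (suc i + r) (trans (sym (+-assoc j (suc i) r)) lr≡)
      cy′≡ : d c y′ ≡ j + suc i
      cy′≡ = geodesic-d-start gp (j + suc i) r lr≡
      yy′≡ : d y y′ ≡ suc i
      yy′≡ = proj₁ (proj₂ (geodesic-split gp j (suc i) r lr≡))
      y∈[c,y′] : InInterval G d y c y′
      y∈[c,y′] = trans cy′≡ (sym (cong₂ _+_ cy≡ yy′≡))
      y′∈[c,a] : InInterval G d y′ c a
      y′∈[c,a] = trans (sym lr≡) (sym (cong₂ _+_ cy′≡ (geodesic-d-end gp (j + suc i) r lr≡)))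

    side-point-almost-as-close : ∀ {c a b p} → IsGeodesic G d c a p → ∀ k e f → k + e ≡ d c a →
                                 d c b ≤ k + f → d a b ≤ e + f → d (p k) b ≤ f + (2 * i + 1)
    side-point-almost-as-close {c} {a} {b} {p} gp k e f ke≡ cb≤ ab≤ with suc i ≤? e
    ... | no i≮e = begin
      d (p k) b          ≤⟨ d-triangle (p k) a b ⟩
      d (p k) a + d a b  ≤⟨ +-mono-≤ (≤-reflexive (geodesic-d-end gp k e ke≡)) ab≤ ⟩
      e + (e + f)        ≤⟨ +-mono-≤ e≤i (+-monoˡ-≤ f e≤i) ⟩
      i + (i + f)        ≡⟨ solve (i ∷ f ∷ []) ⟩
      f + 2 * i          ≤⟨ +-monoʳ-≤ f (m≤m+n (2 * i) 1) ⟩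
      f + (2 * i + 1)    ∎
      where
      e≤i : e ≤ i
      e≤i = ≤-pred (≰⇒> i≮e)
    ... | yes i<e with m≤n⇒∃[o]m+o≡n i<e
    ... | r , refl with α-geodesic-segment gp k r refl (trans (+-assoc k (suc i) r) ke≡) b
    ... | inj₁ (bx≤bx′ , x′-almost) = +-cancelʳ-≤ r _ _ (begin
      d x b + r            ≡⟨ cong₂ _+_ (d-sym x b) (sym x′a≡r) ⟩
      d b x + d x′ a       ≤⟨ +-monoˡ-≤ (d x′ a) bx≤bx′ ⟩
      d b x′ + d x′ a      ≤⟨ x′-almost ⟩
      d b a + i            ≤⟨ +-monoˡ-≤ i (≤-trans (≤-reflexive (d-sym b a)) ab≤) ⟩
      suc i + r + f + i    ≡⟨ solve (i ∷ r ∷ f ∷ []) ⟩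
      f + (2 * i + 1) + r  ∎)
      where
      x x′ : V G
      x = p k
      x′ = p (k + suc i)
      x′a≡r : d x′ a ≡ r
      x′a≡r = geodesic-d-end gp (k + suc i) r (trans (+-assoc k (suc i) r) ke≡)
    ... | inj₂ (_ , x-almost) = +-cancelʳ-≤ k _ _ (begin
      d x b + k            ≡⟨ cong₂ _+_ (d-sym x b) (sym xc≡k) ⟩
      d b x + d x c        ≤⟨ x-almost ⟩
      d b c + i            ≤⟨ +-monoˡ-≤ i (≤-trans (≤-reflexive (d-sym b c)) cb≤) ⟩
      k + f + i            ≤⟨ m≤m+n _ (i + 1) ⟩
      k + f + i + (i + 1)  ≡⟨ solve (k ∷ f ∷ i ∷ []) ⟩
      f + (2 * i + 1) + k  ∎)
      where
      x : V G
      x = p k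
      xc≡k : d x c ≡ k
      xc≡k = trans (d-sym x c) (geodesic-d-start gp k (suc i + r) ke≡)

    almost-as-close⇒near-side-point : ∀ {c b q} → IsGeodesic G d c b q → ∀ k f → k + f ≡ d c b →
                                      ∀ x → d x c ≤ k → d x b ≤ f + (2 * i + 1) → d x (q k) ≤ 3 * suc i
    almost-as-close⇒near-side-point {c} {b} {q} gq k f kf≡ x xc≤k xb≤ with suc i ≤? k
    ... | no i≮k = begin
      d x (q k)          ≤⟨ d-triangle x c (q k) ⟩
      d x c + d c (q k)  ≤⟨ +-mono-≤ xc≤k (≤-reflexive (geodesic-d-start gq k f kf≡)) ⟩
      k + k              ≤⟨ +-mono-≤ k≤i k≤i ⟩
      i + i              ≤⟨ m≤m+n (i + i) (i + 3) ⟩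
      i + i + (i + 3)    ≡⟨ solve (i ∷ []) ⟩
      3 * suc i          ∎
      where
      k≤i : k ≤ i
      k≤i = ≤-pred (≰⇒> i≮k)
    ... | yes i<k with m≤n⇒∃[o]m+o≡n i<k
    ... | s , refl with α-geodesic-segment gq s f (+-comm s (suc i)) kf≡ x
    ... | inj₁ (_ , y-almost) = +-cancelʳ-≤ f _ _ (begin
      d x y + f                ≡⟨ cong (d x y +_) (sym (geodesic-d-end gq (suc i + s) f kf≡)) ⟩
      d x y + d y b            ≤⟨ y-almost ⟩
      d x b + i                ≤⟨ +-monoˡ-≤ i xb≤ ⟩
      f + (2 * i + 1) + i      ≤⟨ m≤m+n _ 2 ⟩
      f + (2 * i + 1) + i + 2  ≡⟨ solve (f ∷ i ∷ []) ⟩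
      3 * suc i + f            ∎)
      where
      y : V G
      y = q (suc i + s)
    ... | inj₂ (xy≤xz , z-almost) = ≤-trans xy≤xz (+-cancelʳ-≤ s _ _ (begin
      d x z + s                ≡⟨ cong (d x z +_) (sym zc≡s) ⟩
      d x z + d z c            ≤⟨ z-almost ⟩
      d x c + i                ≤⟨ +-monoˡ-≤ i xc≤k ⟩
      suc i + s + i            ≤⟨ m≤m+n _ (i + 2) ⟩
      suc i + s + i + (i + 2)  ≡⟨ solve (i ∷ s ∷ []) ⟩
      3 * suc i + s            ∎))
      where
      z : V G
      z = q s
      s+[1+i+f]≡ : s + (suc i + f) ≡ suc i + s + f
      s+[1+i+f]≡ = solve (i ∷ s ∷ f ∷ [])
      zc≡s : d z c ≡ s
      zc≡s = trans (d-sym z c) (geodesic-d-start gq s (suc i + f) (trans s+[1+i+f]≡ kf≡))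

    corner-thin : ∀ {c a b p q} → IsGeodesic G d c a p → IsGeodesic G d c b q →
                  CornerThin G d (3 * suc i) c a b p q
    corner-thin {c} {a} {b} {p} gp gq k gromov with gromov⇒split gromov (d-triangle c a b) ca≤cb+ab
      where
      ca≤cb+ab : d c a ≤ d c b + d a b
      ca≤cb+ab = subst (d c a ≤_) (cong (d c b +_) (d-sym b a)) (d-triangle c b a)
    ... | e , f , ke≡ , kf≡ , ab≤ = almost-as-close⇒near-side-point gq k f kf≡ (p k) xc≤k xb≤
      where
      xc≤k : d (p k) c ≤ k
      xc≤k = ≤-reflexive (trans (d-sym (p k) c) (geodesic-d-start gp k e ke≡))
      xb≤ : d (p k) b ≤ f + (2 * i + 1)
      xb≤ = side-point-almost-as-close gp k e f ke≡ (≤-reflexive (sym kf≡)) ab≤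

theorem1 : (G : Graph) (d : V G → V G → ℕ) → IsDistance G d →
           (i : ℕ) → AlphaMetric G d i →
           ∀ x y z (pxy pyz pzx : ℕ → V G) →
           IsGeodesic G d x y pxy → IsGeodesic G d y z pyz → IsGeodesic G d z x pzx →
           Thin G d (3 * suc i) x y z pxy pyz pzx
theorem1 G d isD i α x y z pxy pyz pzx gxy gyz gzx =
  corner-thin isD α gxy (reverse-geodesic isD gzx) ,
  corner-thin isD α gyz (reverse-geodesic isD gxy) ,
  corner-thin isD α gzx (reverse-geodesic isD gyz)
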